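{- For an Elena $t$ of size $n$, let $\overline{a}(t)=\frac1n\sum_{v}\mathrm{asc}(v)$, where the sum is over all nodes $v$ of $t$ and $\mathrm{asc}(v)$ is the number of nodes on the path from $v$ to the root (including $v$ and the root). If $t$ is chosen uniformly at random among Elenas of size $n$, then the expected value of $\overline{a}(t)$ is asymptotic to $\frac{5-\sqrt5}{20}\,n$ as $n\to\infty$ (it coincides with the expected average number of descendants, where the number of descendants of $v$ is the size of the subtree rooted at $v$).
   Context: Planted plane trees are rooted trees in which the children of every node are linearly ordered. An Elena is a planted plane tree of the following form: there are nodes $v_1,\dots,v_k$ ($k\ge 1$), with $v_1$ the root, such that for each $i<k$ the node $v_{i+1}$ is the rightmost child of $v_i$, the node $v_k$ is a leaf, and for each $i<k$ every other child of $v_i$ (any number $\ge0$ of them, placed to the left of $v_{i+1}$) is the top node of a path (a chain of $\ge1$ nodes each having at most one child). Equivalently, Elenas correspond to words of the language $(\mathtt{a}\,\mathtt{p}^*)^*\mathtt{a}$, with $\mathtt{a}$ a rightmost-branch node and $\mathtt{p}$ an attached path. The size of an Elena is its number of nodes. -}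

module Defs where

open import Data.Nat as ℕ using (ℕ; zero; suc; _∸_)
open import Data.Bool using (Bool; true; false; _∧_; T)
open import Data.List using (List; []; _∷_; [_]; map; concatMap; upTo; filter; length)
open import Data.Nat.ListAction using (sum)
open import Data.Integer as ℤ using (ℤ; +_)
open import Data.Rational using (ℚ; _/_; _*_; _-_; _<_; 0ℚ)
open import Data.Product using (_×_)
open import Data.Sum using (_⊎_)
open import Relation.Unary using (Decidable)
open import Relation.Nullary.Decidable using (yes; no)
open import Data.Bool using (_≟_)

-- Planted plane trees: a node with an ordered list of children.
data Tree : Set where
  node : List Tree → Tree

mutual
  size : Tree → ℕ
  size (node cs) = suc (sizeF cs)

  sizeF : List Tree → ℕ
  sizeF [] = 0
  sizeF (c ∷ cs) = size c ℕ.+ sizeF cs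

mutual
  isPath : Tree → Bool
  isPath (node []) = true
  isPath (node (c ∷ [])) = isPath c
  isPath (node (_ ∷ _ ∷ _)) = false

mutual
  isElena : Tree → Bool
  isElena (node cs) = elenaChildren cs

  elenaChildren : List Tree → Bool
  elenaChildren [] = true
  elenaChildren (c ∷ []) = isElena c
  elenaChildren (c ∷ d ∷ ds) = isPath c ∧ elenaChildren (d ∷ ds)

mutual
  -- sum over all nodes v of asc(v), where the root of the given tree
  -- is at depth d (asc = depth, root has asc 1)
  ascSumAt : ℕ → Tree → ℕ
  ascSumAt d (node cs) = d ℕ.+ ascSumAtF (suc d) cs

  ascSumAtF : ℕ → List Tree → ℕ
  ascSumAtF d [] = 0
  ascSumAtF d (c ∷ cs) = ascSumAt d c ℕ.+ ascSumAtF d cs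

ascTotal : Tree → ℕ
ascTotal t = ascSumAt 1 t

mutual
  descTotal : Tree → ℕ
  descTotal (node cs) = size (node cs) ℕ.+ descTotalF cs

  descTotalF : List Tree → ℕ
  descTotalF [] = 0
  descTotalF (c ∷ cs) = descTotal c ℕ.+ descTotalF cs

-- Enumeration of all forests with m nodes (fuel f; fuel m+1 suffices).
forests : ℕ → ℕ → List (List Tree)
forests zero _ = []
forests (suc f) zero = [ [] ]
forests (suc f) (suc m) =
  concatMap (λ k → concatMap (λ ts → map (λ rest → node ts ∷ rest)
                                         (forests f (m ∸ k)))
                             (forests f k))
            (upTo (suc m))

trees : ℕ → List Tree
trees zero = []
trees (suc m) = map node (forests (suc m) m)

isElena? : Decidable (λ t → T (isElena t))
isElena? t with isElena t
... | true = yes _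
... | false = no (λ z → z)

elenas : ℕ → List Tree
elenas n = filter isElena? (trees n)

-- Expected value of  (1/n) Σ_v f(v)  for a uniformly random Elena of size n:
--   (1 / #elenas) Σ_t (1/n) F(t)  =  (Σ_t F(t)) / (n · #elenas).
-- (Defined as 0 when there is no Elena of size n, i.e. n = 0.)
expectedAvg : (Tree → ℕ) → ℕ → ℚ
expectedAvg F n with n ℕ.* length (elenas n)
... | zero = 0ℚ
... | suc d = (+ sum (map F (elenas n))) / suc d

expectedAvgAsc : ℕ → ℚ
expectedAvgAsc = expectedAvg ascTotal

expectedAvgDesc : ℕ → ℚ
expectedAvgDesc = expectedAvg descTotal

ℕ→ℚ : ℕ → ℚ
ℕ→ℚ k = (+ k) / 1

-- Dedekind cut of the irrational c = (5 - √5)/20, expressed with rationals: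
--   q < c  ⇔  5 - 20q > 0  and  (5 - 20q)² > 5
--   c < q  ⇔  5 - 20q < 0  or   (5 - 20q)² < 5
below-c : ℚ → Set
below-c q = (0ℚ < ℕ→ℚ 5 - ℕ→ℚ 20 * q)
          × (ℕ→ℚ 5 < (ℕ→ℚ 5 - ℕ→ℚ 20 * q) * (ℕ→ℚ 5 - ℕ→ℚ 20 * q))

above-c : ℚ → Set
above-c q = (ℕ→ℚ 5 - ℕ→ℚ 20 * q < 0ℚ)
          ⊎ ((ℕ→ℚ 5 - ℕ→ℚ 20 * q) * (ℕ→ℚ 5 - ℕ→ℚ 20 * q) < ℕ→ℚ 5)

module Submission where

-- The second claim holds tree by tree: both totals count the pairs
-- (ancestor, node).  For the first, write  c m  for the number of Elena
-- forests with m nodes (the child lists of roots of Elenas with m+1 nodes)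
-- and  a m  for their total depth.  Splitting off the first tree of a forest
-- gives linear recursions for c and a, driven by two facts about paths: there
-- is exactly one path forest with k nodes, and its total depth is k(k-1)/2.
-- Solving them (together with the partial sums w of c) shows that c, w are
-- Fibonacci numbers and gives a closed form for a, so the total number of
-- ascendants  S = c + 2mc + a  of all Elenas with n = m+1 nodes satisfies
--     20 S + n² Y = 5 n² c + L,      Y = 2w - c,  0 ≤ L ≤ (50m + 10) c,
-- while Cassini's identity gives  Y² + 4 = 5 c².  Hence the mean S/(nc) is
-- n (5 - Y/c)/20 + O(1) with Y/c → √5.  For a rational l = a/B the cut
-- conditions become statements about X = 5B - 20a, and comparing x c with B Y
-- through their squares decides the sign of the error for all n ≥ 2 (lower
-- bound) resp. n ≥ 2 + 600 B² (upper bound).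

open import Defs

-- (1) Summing the number of descendants over all nodes counts every pair
-- (ancestor, node), exactly as summing the number of ascendants does.
module DescendantsAndAscendants where

  open import Data.Nat using (zero; suc; _+_; _*_)
  open import Data.Nat.Tactic.RingSolver using (solve-∀)
  open import Data.List using ([]; _∷_; length)
  open import Data.List.Properties using (map-cong)
  open import Data.Nat.ListAction using (sum)
  import Data.Integer as ℤ
  open import Data.Rational using (_/_)
  open import Relation.Binary.PropositionalEquality using (_≡_; refl; sym; trans; cong; cong₂)

  mutual
    ascSumAt-suc : ∀ d t → ascSumAt (suc d) t ≡ size t + ascSumAt d t
    ascSumAt-suc d (node cs) =
      trans (cong (suc d +_) (ascSumAtF-suc (suc d) cs)) (shuffle d (sizeF cs) _)
      where
      shuffle : ∀ d s a → suc d + (s + a) ≡ suc s + (d + a)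
      shuffle = solve-∀

    ascSumAtF-suc : ∀ d cs → ascSumAtF (suc d) cs ≡ sizeF cs + ascSumAtF d cs
    ascSumAtF-suc d [] = refl
    ascSumAtF-suc d (c ∷ cs) =
      trans (cong₂ _+_ (ascSumAt-suc d c) (ascSumAtF-suc d cs)) (shuffle (size c) _ _ _)
      where
      shuffle : ∀ s a s' a' → (s + a) + (s' + a') ≡ (s + s') + (a + a')
      shuffle = solve-∀

  mutual
    descTotal≡ascTotal : ∀ t → descTotal t ≡ ascTotal t
    descTotal≡ascTotal (node cs) =
      cong suc (trans (cong (sizeF cs +_) (descTotalF≡ascSumAtF cs)) (sym (ascSumAtF-suc 1 cs)))

    descTotalF≡ascSumAtF : ∀ cs → descTotalF cs ≡ ascSumAtF 1 cs
    descTotalF≡ascSumAtF [] = refl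
    descTotalF≡ascSumAtF (c ∷ cs) = cong₂ _+_ (descTotal≡ascTotal c) (descTotalF≡ascSumAtF cs)

  expectedAvgDesc≡expectedAvgAsc : ∀ n → expectedAvgDesc n ≡ expectedAvgAsc n
  expectedAvgDesc≡expectedAvgAsc n with n * length (elenas n)
  ... | zero = refl
  ... | suc d = cong (λ s → (ℤ.+ s) / suc d) (cong sum (map-cong descTotal≡ascTotal (elenas n)))

-- (2) Sums over lists, over ranges, and over the enumeration of forests.
module ForestSums where

  open import Data.Nat using (ℕ; zero; suc; _+_; _*_; _∸_; _<_; z≤n; s≤s)
  open import Data.Nat.Properties using (+-identityʳ; *-zeroʳ; *-distribˡ-+; *-distribʳ-+; m+[n∸m]≡n)
  open import Data.Nat.Tactic.RingSolver using (solve-∀)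
  open import Data.List using (List; []; _∷_; [_]; map; concatMap; applyUpTo; upTo; _++_)
  open import Data.List.Properties using (map-cong; map-∘; map-++; map-applyUpTo; applyUpTo-∷ʳ)
  open import Data.List.Relation.Unary.All as All using (All; []; _∷_)
  open import Data.List.Relation.Unary.All.Properties using (map⁺; concat⁺; applyUpTo⁺₁)
  open import Data.Nat.ListAction using (sum)
  open import Data.Nat.ListAction.Properties using (sum-++)
  open import Function using (_∘_; id)
  open import Relation.Binary.PropositionalEquality using (_≡_; refl; sym; trans; cong; cong₂; module ≡-Reasoning)

  ∑ : {A : Set} → List A → (A → ℕ) → ℕ
  ∑ xs G = sum (map G xs)

  module _ {A : Set} where

    ∑-++ : ∀ xs ys (G : A → ℕ) → ∑ (xs ++ ys) G ≡ ∑ xs G + ∑ ys G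
    ∑-++ xs ys G = trans (cong sum (map-++ G xs ys)) (sum-++ (map G xs) (map G ys))

    ∑-congᴬ : ∀ {P : A → Set} {G H : A → ℕ} → (∀ {x} → P x → G x ≡ H x) →
              ∀ {xs} → All P xs → ∑ xs G ≡ ∑ xs H
    ∑-congᴬ G≡H [] = refl
    ∑-congᴬ G≡H (p ∷ ps) = cong₂ _+_ (G≡H p) (∑-congᴬ G≡H ps)

    ∑-cong : ∀ xs {G H : A → ℕ} → (∀ x → G x ≡ H x) → ∑ xs G ≡ ∑ xs H
    ∑-cong xs G≡H = cong sum (map-cong G≡H xs)

    ∑-+ : ∀ xs (G H : A → ℕ) → ∑ xs (λ x → G x + H x) ≡ ∑ xs G + ∑ xs H
    ∑-+ [] G H = refl
    ∑-+ (x ∷ xs) G H = trans (cong (G x + H x +_) (∑-+ xs G H)) (interchange (G x) (H x) _ _)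
      where
      interchange : ∀ a b c d → a + b + (c + d) ≡ a + c + (b + d)
      interchange = solve-∀

    ∑-*ˡ : ∀ xs k (G : A → ℕ) → ∑ xs (λ x → k * G x) ≡ k * ∑ xs G
    ∑-*ˡ [] k G = sym (*-zeroʳ k)
    ∑-*ˡ (x ∷ xs) k G = trans (cong (k * G x +_) (∑-*ˡ xs k G)) (sym (*-distribˡ-+ k (G x) _))

    ∑-*ʳ : ∀ xs (G : A → ℕ) k → ∑ xs (λ x → G x * k) ≡ ∑ xs G * k
    ∑-*ʳ [] G k = refl
    ∑-*ʳ (x ∷ xs) G k = trans (cong (G x * k +_) (∑-*ʳ xs G k)) (sym (*-distribʳ-+ k (G x) _))

    ∑-zero : ∀ xs → ∑ xs (λ (_ : A) → 0) ≡ 0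
    ∑-zero [] = refl
    ∑-zero (x ∷ xs) = ∑-zero xs

  module _ {A B : Set} where

    ∑-map : ∀ (h : A → B) xs (G : B → ℕ) → ∑ (map h xs) G ≡ ∑ xs (G ∘ h)
    ∑-map h xs G = cong sum (sym (map-∘ xs))

    ∑-concatMap : ∀ (h : A → List B) xs (G : B → ℕ) → ∑ (concatMap h xs) G ≡ ∑ xs (λ x → ∑ (h x) G)
    ∑-concatMap h [] G = refl
    ∑-concatMap h (x ∷ xs) G = trans (∑-++ (h x) _ G) (cong (∑ (h x) G +_) (∑-concatMap h xs G))

    ∑-product : ∀ xs ys (g : A → ℕ) (h : B → ℕ) →
                ∑ xs (λ x → ∑ ys (λ y → g x * h y)) ≡ ∑ xs g * ∑ ys h
    ∑-product xs ys g h = trans (∑-cong xs (λ x → ∑-*ˡ ys (g x) h)) (∑-*ʳ xs g (∑ ys h))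

    ∑-bilinear : ∀ xs ys (g₁ g₂ : A → ℕ) (h₁ h₂ : B → ℕ) →
                 ∑ xs (λ x → ∑ ys (λ y → g₁ x * h₁ y + g₂ x * h₂ y)) ≡ ∑ xs g₁ * ∑ ys h₁ + ∑ xs g₂ * ∑ ys h₂
    ∑-bilinear xs ys g₁ g₂ h₁ h₂ =
      trans (∑-cong xs (λ x → ∑-+ ys (λ y → g₁ x * h₁ y) (λ y → g₂ x * h₂ y)))
            (trans (∑-+ xs _ _) (cong₂ _+_ (∑-product xs ys g₁ h₁) (∑-product xs ys g₂ h₂)))

  Σ< : ℕ → (ℕ → ℕ) → ℕ
  Σ< n g = sum (applyUpTo g n)

  ∑-upTo : ∀ n g → ∑ (upTo n) g ≡ Σ< n g
  ∑-upTo n g = cong sum (map-applyUpTo id g n)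

  Σ<-last : ∀ n g → Σ< (suc n) g ≡ Σ< n g + g n
  Σ<-last n g = trans (cong sum (sym (applyUpTo-∷ʳ g n))) (trans (sum-++ (applyUpTo g n) [ g n ])
                  (cong (Σ< n g +_) (+-identityʳ (g n))))

  Σ<-cong : ∀ n {g h} → (∀ k → k < n → g k ≡ h k) → Σ< n g ≡ Σ< n h
  Σ<-cong zero g≡h = refl
  Σ<-cong (suc n) g≡h = cong₂ _+_ (g≡h 0 (s≤s z≤n)) (Σ<-cong n (λ k k<n → g≡h (suc k) (s≤s k<n)))

  Σ<-+ : ∀ n g h → Σ< n (λ k → g k + h k) ≡ Σ< n g + Σ< n h
  Σ<-+ zero g h = refl
  Σ<-+ (suc n) g h = trans (cong (g 0 + h 0 +_) (Σ<-+ n (g ∘ suc) (h ∘ suc))) (interchange (g 0) (h 0) _ _)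
    where
    interchange : ∀ a b c d → a + b + (c + d) ≡ a + c + (b + d)
    interchange = solve-∀

  Σ<-zero : ∀ n → Σ< n (λ _ → 0) ≡ 0
  Σ<-zero zero = refl
  Σ<-zero (suc n) = Σ<-zero n

  ΣF : ℕ → ℕ → (List Tree → ℕ) → ℕ
  ΣF f m G = ∑ (forests f m) G

  ΣF-unfold : ∀ f m G → ΣF (suc f) (suc m) G ≡
    Σ< (suc m) (λ k → ΣF f k (λ ts → ΣF f (m ∸ k) (λ rest → G (node ts ∷ rest))))
  ΣF-unfold f m G = begin
    ∑ (concatMap splits (upTo (suc m))) G
      ≡⟨ ∑-concatMap splits (upTo (suc m)) G ⟩
    ∑ (upTo (suc m)) (λ k → ∑ (splits k) G)
      ≡⟨ ∑-cong (upTo (suc m)) (λ k → trans (∑-concatMap (firstTree k) (forests f k) G)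
                                      (∑-cong (forests f k) (λ ts → ∑-map (node ts ∷_) (forests f (m ∸ k)) G))) ⟩
    ∑ (upTo (suc m)) (λ k → ΣF f k (λ ts → ΣF f (m ∸ k) (λ rest → G (node ts ∷ rest))))
      ≡⟨ ∑-upTo (suc m) _ ⟩
    Σ< (suc m) (λ k → ΣF f k (λ ts → ΣF f (m ∸ k) (λ rest → G (node ts ∷ rest)))) ∎
    where
    open ≡-Reasoning
    firstTree : ℕ → List Tree → List (List Tree)
    firstTree k ts = map (node ts ∷_) (forests f (m ∸ k))
    splits : ℕ → List (List Tree)
    splits k = concatMap (firstTree k) (forests f k)

  forests-size : ∀ f m → All (λ fs → sizeF fs ≡ m) (forests f m)
  forests-size zero m = []
  forests-size (suc f) zero = refl ∷ []
  forests-size (suc f) (suc m) = concat⁺ (map⁺ (applyUpTo⁺₁ id (suc m) (λ {k} k≤m →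
    concat⁺ (map⁺ (All.map (λ {ts} ts-size → map⁺ (All.map (λ {rest} rest-size → size-cons {ts} {rest} ts-size rest-size k≤m)
                                                           (forests-size f (m ∸ k))))
                           (forests-size f k))))))
    where
    size-cons : ∀ {ts rest k} → sizeF ts ≡ k → sizeF rest ≡ m ∸ k → k < suc m → sizeF (node ts ∷ rest) ≡ suc m
    size-cons {ts} {rest} refl rest-size (s≤s k≤m) =
      cong suc (trans (cong (sizeF ts +_) rest-size) (m+[n∸m]≡n k≤m))

  ΣF-congˢ : ∀ f m {G H} → (∀ fs → sizeF fs ≡ m → G fs ≡ H fs) → ΣF f m G ≡ ΣF f m H
  ΣF-congˢ f m G≡H = ∑-congᴬ (λ {fs} → G≡H fs) (forests-size f m)

  ΣF-size : ∀ f m G → ΣF f m (λ fs → G fs * sizeF fs) ≡ ΣF f m G * m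
  ΣF-size f m G = trans (ΣF-congˢ f m (λ fs e → cong (G fs *_) e)) (∑-*ʳ (forests f m) G m)

-- (3) Counting Elena forests.  An Elena forest is the child list of the root
-- of an Elena: all trees are paths except the last one, which is the root of
-- an Elena.
module ElenaForests where

  open import Data.Nat using (ℕ; zero; suc; _+_; _*_; _∸_; _≤_; _<_; s≤s)
  open import Data.Nat.Properties using (+-identityʳ; *-identityˡ; +-∸-assoc; n∸n≡0; m∸n≤m; <-trans; ≤-<-trans)
  open import Data.Nat.Tactic.RingSolver using (solve-∀)
  open import Data.Bool using (Bool; true; false; _∧_)
  open import Data.List using (List; []; _∷_; [_])
  open import Relation.Binary.PropositionalEquality using (_≡_; refl; sym; trans; cong; cong₂; subst; module ≡-Reasoning)
  open ForestSums
  open DescendantsAndAscendants using (ascSumAtF-suc)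

  ⟦_⟧ : Bool → ℕ
  ⟦ true ⟧ = 1
  ⟦ false ⟧ = 0

  ⟦∧⟧ : ∀ a b → ⟦ a ∧ b ⟧ ≡ ⟦ a ⟧ * ⟦ b ⟧
  ⟦∧⟧ true b = sym (+-identityʳ ⟦ b ⟧)
  ⟦∧⟧ false b = refl

  -- A path forest is empty or consists of a single path.
  isPathForest : List Tree → Bool
  isPathForest ts = isPath (node ts)

  -- Total depth of a forest whose roots have depth 0.
  depthSum : List Tree → ℕ
  depthSum = ascSumAtF 0

  depthSum-cons : ∀ ts rest → depthSum (node ts ∷ rest) ≡ (sizeF ts + depthSum ts) + depthSum rest
  depthSum-cons ts rest = cong (_+ depthSum rest) (ascSumAtF-suc 0 ts)

  depthSum-single : ∀ ts → depthSum [ node ts ] ≡ sizeF ts + depthSum ts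
  depthSum-single ts = trans (depthSum-cons ts []) (+-identityʳ _)

  -- The counting sequences, produced by one simultaneous recursion:
  --   c m  = number of Elena forests with m nodes,
  --   a m  = their total depth,
  --   w m  = Σ_{k<m} c (m-k),   v m = Σ_{k<m} (k+1) c (m-k),
  --   u m  = Σ_{k<m} ((k + tri k) c (m-k) + a (m-k)).
  record Counts : Set where
    constructor counts
    field c w v u a : ℕ

  next : ℕ → Counts → Counts
  next m (counts c w v u a) = counts c′ (c′ + w) (c′ + v + w) (a′ + u + v) a′
    where
    c′ a′ : ℕ
    c′ = w + c
    a′ = u + m * c + a

  countsAt : ℕ → Counts
  countsAt zero = counts 1 0 0 0 0
  countsAt (suc m) = next m (countsAt m)

  c w v u a : ℕ → ℕ
  c m = Counts.c (countsAt m)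
  w m = Counts.w (countsAt m)
  v m = Counts.v (countsAt m)
  u m = Counts.u (countsAt m)
  a m = Counts.a (countsAt m)

  -- tri k = 0 + 1 + … + (k-1), the total depth of a path with k nodes.
  tri : ℕ → ℕ
  tri zero = 0
  tri (suc k) = k + tri k

  Σ<-w : ∀ m → Σ< m (λ k → c (m ∸ k)) ≡ w m
  Σ<-w zero = refl
  Σ<-w (suc m) = cong (c (suc m) +_) (Σ<-w m)

  Σ<-v : ∀ m → Σ< m (λ k → suc k * c (m ∸ k)) ≡ v m
  Σ<-v zero = refl
  Σ<-v (suc m) = begin
    (c (suc m) + 0) + Σ< m (λ k → suc (suc k) * c (m ∸ k))
      ≡⟨ cong₂ _+_ (+-identityʳ _) (Σ<-cong m (λ k _ → split k (c (m ∸ k)))) ⟩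
    c (suc m) + Σ< m (λ k → suc k * c (m ∸ k) + c (m ∸ k))
      ≡⟨ cong (c (suc m) +_) (trans (Σ<-+ m _ _) (cong₂ _+_ (Σ<-v m) (Σ<-w m))) ⟩
    c (suc m) + (v m + w m)
      ≡⟨ sym (+-assoc' (c (suc m)) (v m) (w m)) ⟩
    c (suc m) + v m + w m ∎
    where
    open ≡-Reasoning
    split : ∀ k x → suc (suc k) * x ≡ suc k * x + x
    split = solve-∀
    +-assoc' : ∀ x y z → x + y + z ≡ x + (y + z)
    +-assoc' = solve-∀

  Σ<-u : ∀ m → Σ< m (λ k → (k + tri k) * c (m ∸ k) + a (m ∸ k)) ≡ u m
  Σ<-u zero = refl
  Σ<-u (suc m) = begin
    a (suc m) + Σ< m (λ k → (suc k + tri (suc k)) * c (m ∸ k) + a (m ∸ k))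
      ≡⟨ cong (a (suc m) +_) (Σ<-cong m (λ k _ → split k (tri k) (c (m ∸ k)) (a (m ∸ k)))) ⟩
    a (suc m) + Σ< m (λ k → ((k + tri k) * c (m ∸ k) + a (m ∸ k)) + suc k * c (m ∸ k))
      ≡⟨ cong (a (suc m) +_) (trans (Σ<-+ m _ _) (cong₂ _+_ (Σ<-u m) (Σ<-v m))) ⟩
    a (suc m) + (u m + v m)
      ≡⟨ sym (+-assoc' (a (suc m)) (u m) (v m)) ⟩
    a (suc m) + u m + v m ∎
    where
    open ≡-Reasoning
    split : ∀ k t x y → (suc k + (k + t)) * x + y ≡ ((k + t) * x + y) + suc k * x
    split = solve-∀
    +-assoc' : ∀ x y z → x + y + z ≡ x + (y + z)
    +-assoc' = solve-∀

  -- With fuel f > m this turns a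
  -- sum over forests into a recursion; p k r is the contribution of a first
  -- tree with k nodes followed by a forest with r > 0 nodes.
  ΣF-recursion : ∀ f m G (p : ℕ → ℕ → ℕ) {q} → m < f →
    (∀ k r → k < f → suc r < f → ΣF f k (λ ts → ΣF f (suc r) (λ rest → G (node ts ∷ rest))) ≡ p k (suc r)) →
    ΣF f m (λ ts → G [ node ts ]) ≡ q →
    ΣF (suc f) (suc m) G ≡ Σ< m (λ k → p k (m ∸ k)) + q
  ΣF-recursion f@(suc _) m G p {q} m<f part single = begin
    ΣF (suc f) (suc m) G
      ≡⟨ ΣF-unfold f m G ⟩
    Σ< (suc m) (λ k → ΣF f k (λ ts → ΣF f (m ∸ k) (λ rest → G (node ts ∷ rest))))
      ≡⟨ Σ<-last m _ ⟩
    Σ< m (λ k → ΣF f k (λ ts → ΣF f (m ∸ k) (λ rest → G (node ts ∷ rest))))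
      + ΣF f m (λ ts → ΣF f (m ∸ m) (λ rest → G (node ts ∷ rest)))
      ≡⟨ cong₂ _+_ (Σ<-cong m split) lastTree ⟩
    Σ< m (λ k → p k (m ∸ k)) + q ∎
    where
    open ≡-Reasoning
    split : ∀ k → k < m → ΣF f k (λ ts → ΣF f (m ∸ k) (λ rest → G (node ts ∷ rest))) ≡ p k (m ∸ k)
    split k k<m = subst (λ r → ΣF f k (λ ts → ΣF f r (λ rest → G (node ts ∷ rest))) ≡ p k r)
                        (sym m∸k≡suc) (part k (m ∸ suc k) (<-trans k<m m<f) rest<f)
      where
      m∸k≡suc : m ∸ k ≡ suc (m ∸ suc k)
      m∸k≡suc = +-∸-assoc 1 k<m
      rest<f : suc (m ∸ suc k) < f
      rest<f = ≤-<-trans (subst (_≤ m) m∸k≡suc (m∸n≤m m k)) m<f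
    lastTree : ΣF f m (λ ts → ΣF f (m ∸ m) (λ rest → G (node ts ∷ rest))) ≡ q
    lastTree = trans (∑-cong (forests f m) (λ ts → trans (cong (λ r → ΣF f r (λ rest → G (node ts ∷ rest))) (n∸n≡0 m))
                                                        (+-identityʳ _)))
                     single

  ΣF-nonempty : ∀ f r {G H} → (∀ x xs → G (x ∷ xs) ≡ H (x ∷ xs)) → ΣF f (suc r) G ≡ ΣF f (suc r) H
  ΣF-nonempty f r G≡H = ΣF-congˢ f (suc r) λ { (x ∷ xs) _ → G≡H x xs ; [] () }

  ΣF-sizeDepth : ∀ f m (b : List Tree → Bool) →
    ΣF f m (λ ts → ⟦ b ts ⟧ * (sizeF ts + depthSum ts)) ≡ ΣF f m (λ ts → ⟦ b ts ⟧) * m + ΣF f m (λ ts → ⟦ b ts ⟧ * depthSum ts)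
  ΣF-sizeDepth f m b = trans (∑-cong (forests f m) (λ ts → *-distribˡ-+' ⟦ b ts ⟧ (sizeF ts) (depthSum ts)))
                             (trans (∑-+ (forests f m) _ _) (cong (_+ ΣF f m (λ ts → ⟦ b ts ⟧ * depthSum ts)) (ΣF-size f m (λ ts → ⟦ b ts ⟧))))
    where
    *-distribˡ-+' : ∀ x y z → x * (y + z) ≡ x * y + x * z
    *-distribˡ-+' = solve-∀

  pathCount : ∀ f m → m < f → ΣF f m (λ ts → ⟦ isPathForest ts ⟧) ≡ 1
  pathCount (suc f) zero _ = refl
  pathCount (suc f) (suc m) (s≤s m<f) =
    trans (ΣF-recursion f m _ (λ _ _ → 0) m<f noSplit (pathCount f m m<f)) (cong (_+ 1) (Σ<-zero m))
    where
    noSplit : ∀ k r → k < f → suc r < f → ΣF f k (λ ts → ΣF f (suc r) (λ rest → ⟦ isPathForest (node ts ∷ rest) ⟧)) ≡ 0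
    noSplit k r _ _ = trans (∑-cong (forests f k) (λ ts → trans (ΣF-nonempty f r (λ _ _ → refl)) (∑-zero (forests f (suc r)))))
                            (∑-zero (forests f k))

  pathDepth : ∀ f m → m < f → ΣF f m (λ ts → ⟦ isPathForest ts ⟧ * depthSum ts) ≡ tri m
  pathDepth (suc f) zero _ = refl
  pathDepth (suc f) (suc m) (s≤s m<f) =
    trans (ΣF-recursion f m _ (λ _ _ → 0) m<f noSplit single) (cong (_+ (m + tri m)) (Σ<-zero m))
    where
    noSplit : ∀ k r → k < f → suc r < f →
      ΣF f k (λ ts → ΣF f (suc r) (λ rest → ⟦ isPathForest (node ts ∷ rest) ⟧ * depthSum (node ts ∷ rest))) ≡ 0
    noSplit k r _ _ = trans (∑-cong (forests f k) (λ ts → trans (ΣF-nonempty f r (λ _ _ → refl)) (∑-zero (forests f (suc r)))))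
                            (∑-zero (forests f k))
    single : ΣF f m (λ ts → ⟦ isPathForest ts ⟧ * depthSum [ node ts ]) ≡ m + tri m
    single = begin
      ΣF f m (λ ts → ⟦ isPathForest ts ⟧ * depthSum [ node ts ])
        ≡⟨ ∑-cong (forests f m) (λ ts → cong (⟦ isPathForest ts ⟧ *_) (depthSum-single ts)) ⟩
      ΣF f m (λ ts → ⟦ isPathForest ts ⟧ * (sizeF ts + depthSum ts))
        ≡⟨ ΣF-sizeDepth f m isPathForest ⟩
      ΣF f m (λ ts → ⟦ isPathForest ts ⟧) * m + ΣF f m (λ ts → ⟦ isPathForest ts ⟧ * depthSum ts)
        ≡⟨ cong₂ _+_ (trans (cong (_* m) (pathCount f m m<f)) (*-identityˡ m)) (pathDepth f m m<f) ⟩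
      m + tri m ∎
      where open ≡-Reasoning

  elenaChildren-cons : ∀ ts x xs →
    ⟦ elenaChildren (node ts ∷ x ∷ xs) ⟧ ≡ ⟦ isPathForest ts ⟧ * ⟦ elenaChildren (x ∷ xs) ⟧
  elenaChildren-cons ts x xs = ⟦∧⟧ (isPathForest ts) (elenaChildren (x ∷ xs))

  elenaCount : ∀ f m → m < f → ΣF f m (λ ts → ⟦ elenaChildren ts ⟧) ≡ c m
  elenaCount (suc f) zero _ = refl
  elenaCount (suc f) (suc m) (s≤s m<f) =
    trans (ΣF-recursion f m _ (λ _ r → c r) m<f split (elenaCount f m m<f)) (cong (_+ c m) (Σ<-w m))
    where
    split : ∀ k r → k < f → suc r < f →
      ΣF f k (λ ts → ΣF f (suc r) (λ rest → ⟦ elenaChildren (node ts ∷ rest) ⟧)) ≡ c (suc r)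
    split k r k<f r<f = begin
      ΣF f k (λ ts → ΣF f (suc r) (λ rest → ⟦ elenaChildren (node ts ∷ rest) ⟧))
        ≡⟨ ∑-cong (forests f k) (λ ts → ΣF-nonempty f r (elenaChildren-cons ts)) ⟩
      ΣF f k (λ ts → ΣF f (suc r) (λ rest → ⟦ isPathForest ts ⟧ * ⟦ elenaChildren rest ⟧))
        ≡⟨ ∑-product (forests f k) (forests f (suc r)) _ _ ⟩
      ΣF f k (λ ts → ⟦ isPathForest ts ⟧) * ΣF f (suc r) (λ rest → ⟦ elenaChildren rest ⟧)
        ≡⟨ cong₂ _*_ (pathCount f k k<f) (elenaCount f (suc r) r<f) ⟩
      1 * c (suc r)
        ≡⟨ *-identityˡ _ ⟩
      c (suc r) ∎
      where open ≡-Reasoning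

  elenaDepth : ∀ f m → m < f → ΣF f m (λ ts → ⟦ elenaChildren ts ⟧ * depthSum ts) ≡ a m
  elenaDepth (suc f) zero _ = refl
  elenaDepth (suc f) (suc m) (s≤s m<f) =
    trans (ΣF-recursion f m _ (λ k r → (k + tri k) * c r + a r) m<f split single)
          (trans (cong (_+ (c m * m + a m)) (Σ<-u m)) (regroup (u m) (c m) m (a m)))
    where
    regroup : ∀ u c m a → u + (c * m + a) ≡ u + m * c + a
    regroup = solve-∀
    expand : ∀ p e s d d′ → (p * e) * ((s + d) + d′) ≡ (p * (s + d)) * e + p * (e * d′)
    expand = solve-∀
    split : ∀ k r → k < f → suc r < f →
      ΣF f k (λ ts → ΣF f (suc r) (λ rest → ⟦ elenaChildren (node ts ∷ rest) ⟧ * depthSum (node ts ∷ rest)))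
      ≡ (k + tri k) * c (suc r) + a (suc r)
    split k r k<f r<f = begin
      ΣF f k (λ ts → ΣF f (suc r) (λ rest → ⟦ elenaChildren (node ts ∷ rest) ⟧ * depthSum (node ts ∷ rest)))
        ≡⟨ ∑-cong (forests f k) (λ ts → ΣF-nonempty f r (λ x xs →
             trans (cong₂ _*_ (elenaChildren-cons ts x xs) (depthSum-cons ts (x ∷ xs)))
                   (expand ⟦ isPathForest ts ⟧ ⟦ elenaChildren (x ∷ xs) ⟧ (sizeF ts) (depthSum ts) (depthSum (x ∷ xs))))) ⟩
      ΣF f k (λ ts → ΣF f (suc r) (λ rest → (⟦ isPathForest ts ⟧ * (sizeF ts + depthSum ts)) * ⟦ elenaChildren rest ⟧
                                          + ⟦ isPathForest ts ⟧ * (⟦ elenaChildren rest ⟧ * depthSum rest)))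
        ≡⟨ ∑-bilinear (forests f k) (forests f (suc r)) _ _ _ _ ⟩
      ΣF f k (λ ts → ⟦ isPathForest ts ⟧ * (sizeF ts + depthSum ts)) * ΣF f (suc r) (λ rest → ⟦ elenaChildren rest ⟧)
        + ΣF f k (λ ts → ⟦ isPathForest ts ⟧) * ΣF f (suc r) (λ rest → ⟦ elenaChildren rest ⟧ * depthSum rest)
        ≡⟨ cong₂ _+_ (cong₂ _*_ (trans (ΣF-sizeDepth f k isPathForest)
                                       (cong₂ _+_ (trans (cong (_* k) (pathCount f k k<f)) (*-identityˡ k)) (pathDepth f k k<f)))
                                (elenaCount f (suc r) r<f))
                     (trans (cong₂ _*_ (pathCount f k k<f) (elenaDepth f (suc r) r<f)) (*-identityˡ _)) ⟩
      (k + tri k) * c (suc r) + a (suc r) ∎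
      where open ≡-Reasoning
    single : ΣF f m (λ ts → ⟦ elenaChildren ts ⟧ * depthSum [ node ts ]) ≡ c m * m + a m
    single = begin
      ΣF f m (λ ts → ⟦ elenaChildren ts ⟧ * depthSum [ node ts ])
        ≡⟨ ∑-cong (forests f m) (λ ts → cong (⟦ elenaChildren ts ⟧ *_) (depthSum-single ts)) ⟩
      ΣF f m (λ ts → ⟦ elenaChildren ts ⟧ * (sizeF ts + depthSum ts))
        ≡⟨ ΣF-sizeDepth f m elenaChildren ⟩
      ΣF f m (λ ts → ⟦ elenaChildren ts ⟧) * m + ΣF f m (λ ts → ⟦ elenaChildren ts ⟧ * depthSum ts)
        ≡⟨ cong₂ _+_ (cong (_* m) (elenaCount f m m<f)) (elenaDepth f m m<f) ⟩
      c m * m + a m ∎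
      where open ≡-Reasoning

-- (4) The Elenas with m+1 nodes are the roots of the Elena forests with m
-- nodes; their number is c m and their total number of ascendants is S m.
module ElenaStatistics where

  open import Data.Nat using (ℕ; suc; _+_; _*_)
  open import Data.Nat.Properties using (≤-refl; +-identityʳ)
  open import Data.Nat.Tactic.RingSolver using (solve-∀)
  open import Data.Bool using (true; false)
  open import Data.List using ([]; _∷_; filter; length)
  import Data.Integer as ℤ
  open import Data.Rational using (_/_)
  open import Relation.Binary.PropositionalEquality using (_≡_; refl; sym; trans; cong; cong₂; module ≡-Reasoning)
  open ForestSums
  open ElenaForests
  open DescendantsAndAscendants using (ascSumAtF-suc)

  S : ℕ → ℕ
  S m = c m + 2 * m * c m + a m

  ∑-filter : ∀ (G : Tree → ℕ) xs → ∑ (filter isElena? xs) G ≡ ∑ xs (λ t → ⟦ isElena t ⟧ * G t)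
  ∑-filter G [] = refl
  ∑-filter G (t ∷ ts) with isElena t
  ... | true = cong₂ _+_ (sym (+-identityʳ (G t))) (∑-filter G ts)
  ... | false = ∑-filter G ts

  length-filter : ∀ xs → length (filter isElena? xs) ≡ ∑ xs (λ t → ⟦ isElena t ⟧)
  length-filter [] = refl
  length-filter (t ∷ ts) with isElena t
  ... | true = cong suc (length-filter ts)
  ... | false = length-filter ts

  ∑-elenas : ∀ m G → ∑ (elenas (suc m)) G ≡ ΣF (suc m) m (λ fs → ⟦ elenaChildren fs ⟧ * G (node fs))
  ∑-elenas m G = trans (∑-filter G (trees (suc m))) (∑-map node (forests (suc m) m) _)

  elenaNumber : ∀ m → length (elenas (suc m)) ≡ c m
  elenaNumber m = trans (length-filter (trees (suc m)))
                        (trans (∑-map node (forests (suc m) m) _) (elenaCount (suc m) m ≤-refl))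

  -- The root has one ascendant, each other node one more than its depth
  -- below the root's children.
  ascTotal-node : ∀ fs → ascTotal (node fs) ≡ suc (sizeF fs + (sizeF fs + depthSum fs))
  ascTotal-node fs = cong suc (trans (ascSumAtF-suc 1 fs) (cong (sizeF fs +_) (ascSumAtF-suc 0 fs)))

  ascTotalSum : ∀ m → ∑ (elenas (suc m)) ascTotal ≡ S m
  ascTotalSum m = begin
    ∑ (elenas (suc m)) ascTotal
      ≡⟨ ∑-elenas m ascTotal ⟩
    ΣF f m (λ fs → ⟦ elenaChildren fs ⟧ * ascTotal (node fs))
      ≡⟨ ∑-cong (forests f m) (λ fs → trans (cong (⟦ elenaChildren fs ⟧ *_) (ascTotal-node fs))
                                            (expand ⟦ elenaChildren fs ⟧ (sizeF fs) (depthSum fs))) ⟩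
    ΣF f m (λ fs → (⟦ elenaChildren fs ⟧ + ⟦ elenaChildren fs ⟧ * sizeF fs)
                   + ⟦ elenaChildren fs ⟧ * (sizeF fs + depthSum fs))
      ≡⟨ trans (∑-+ (forests f m) _ _) (cong₂ _+_ (∑-+ (forests f m) _ _) (ΣF-sizeDepth f m elenaChildren)) ⟩
    (ΣF f m (λ fs → ⟦ elenaChildren fs ⟧) + ΣF f m (λ fs → ⟦ elenaChildren fs ⟧ * sizeF fs))
      + (ΣF f m (λ fs → ⟦ elenaChildren fs ⟧) * m + ΣF f m (λ fs → ⟦ elenaChildren fs ⟧ * depthSum fs))
      ≡⟨ cong₂ _+_ (cong₂ _+_ count (trans (ΣF-size f m _) (cong (_* m) count)))
                   (cong₂ _+_ (cong (_* m) count) (elenaDepth f m ≤-refl)) ⟩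
    (c m + c m * m) + (c m * m + a m)
      ≡⟨ regroup (c m) m (a m) ⟩
    S m ∎
    where
    open ≡-Reasoning
    f = suc m
    count : ΣF f m (λ fs → ⟦ elenaChildren fs ⟧) ≡ c m
    count = elenaCount f m ≤-refl
    expand : ∀ e s d → e * suc (s + (s + d)) ≡ (e + e * s) + e * (s + d)
    expand = solve-∀
    regroup : ∀ c m a → (c + c * m) + (c * m + a) ≡ c + 2 * m * c + a
    regroup = solve-∀

  expectedAvgAsc-formula : ∀ m d → suc m * c m ≡ suc d → expectedAvgAsc (suc m) ≡ (ℤ.+ S m) / suc d
  expectedAvgAsc-formula m d e with suc m * length (elenas (suc m)) | cong (suc m *_) (elenaNumber m)
  ... | .(suc m * c m) | refl with suc m * c m | e
  ... | .(suc d) | refl = cong (λ s → (ℤ.+ s) / suc d) (ascTotalSum m)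

-- (5) The counts are odd-indexed Fibonacci numbers: c (m+1) = c m + w m and
-- w (m+1) = w m + c (m+1).
module Fibonacci where

  open import Data.Nat using (ℕ; zero; suc; _+_; _*_; _∸_; _≤_; z≤n; s≤s)
  open import Data.Nat.Properties
    using (≤-trans; m≤n+m; m≤m+n; +-monoʳ-≤; +-mono-≤; *-monoʳ-≤; m∸n+n≡m; +-cancelʳ-≡; +-cancelʳ-≤; module ≤-Reasoning)
  open import Data.Nat.Tactic.RingSolver using (solve-∀)
  open import Relation.Binary.PropositionalEquality using (_≡_; refl; sym; cong; module ≡-Reasoning)
  open ElenaForests using (c; w)

  c-pos : ∀ m → 1 ≤ c m
  c-pos zero = s≤s z≤n
  c-pos (suc m) = ≤-trans (c-pos m) (m≤n+m (c m) (w m))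

  c≤w : ∀ m → c (suc m) ≤ w (suc m)
  c≤w m = m≤m+n (c (suc m)) (w m)

  w≤2c : ∀ m → w m ≤ 2 * c m
  w≤2c zero = z≤n
  w≤2c (suc m) = +-monoʳ-≤ (c (suc m)) (≤-trans (m≤m+n (w m) (c m)) (m≤m+n (c (suc m)) 0))

  m≤c : ∀ m → m ≤ c m
  m≤c zero = z≤n
  m≤c (suc zero) = s≤s z≤n
  m≤c (suc (suc m)) = +-mono-≤ (≤-trans (c-pos (suc m)) (c≤w m)) (m≤c (suc m))

  cassini : ∀ m → w m * w m + 1 ≡ c m * c m + c m * w m
  cassini zero = refl
  cassini (suc m) = begin
    (W + C + W) * (W + C + W) + 1             ≡⟨ expand W C ⟩
    (C * C + 4 * C * W + 3 * W * W) + (W * W + 1) ≡⟨ cong (C * C + 4 * C * W + 3 * W * W +_) (cassini m) ⟩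
    (C * C + 4 * C * W + 3 * W * W) + (C * C + C * W) ≡⟨ collect W C ⟩
    (W + C) * (W + C) + (W + C) * (W + C + W) ∎
    where
    open ≡-Reasoning
    C = c m
    W = w m
    expand : ∀ W C → (W + C + W) * (W + C + W) + 1 ≡ (C * C + 4 * C * W + 3 * W * W) + (W * W + 1)
    expand = solve-∀
    collect : ∀ W C → (C * C + 4 * C * W + 3 * W * W) + (C * C + C * W) ≡ (W + C) * (W + C) + (W + C) * (W + C + W)
    collect = solve-∀

  -- Y m = 2 w m - c m, which approximates √5 · c m.
  Y : ℕ → ℕ
  Y m = 2 * w m ∸ c m

  Y+c : ∀ m → Y (suc m) + c (suc m) ≡ 2 * w (suc m)
  Y+c m = m∸n+n≡m (≤-trans (c≤w m) (m≤m+n (w (suc m)) (w (suc m) + 0)))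

  Y²+4≡5c² : ∀ m → Y (suc m) * Y (suc m) + 4 ≡ 5 * (c (suc m) * c (suc m))
  Y²+4≡5c² m = +-cancelʳ-≡ (2 * Yₘ * C + C * C) _ _ (begin
    Yₘ * Yₘ + 4 + (2 * Yₘ * C + C * C)  ≡⟨ square Yₘ C ⟩
    (Yₘ + C) * (Yₘ + C) + 4              ≡⟨ cong (λ t → t * t + 4) (Y+c m) ⟩
    (2 * W) * (2 * W) + 4                ≡⟨ four W ⟩
    4 * (W * W + 1)                      ≡⟨ cong (4 *_) (cassini (suc m)) ⟩
    4 * (C * C + C * W)                  ≡⟨ twice C W ⟩
    4 * (C * C) + 2 * C * (2 * W)        ≡⟨ cong (λ t → 4 * (C * C) + 2 * C * t) (sym (Y+c m)) ⟩
    4 * (C * C) + 2 * C * (Yₘ + C)       ≡⟨ regroup C Yₘ ⟩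
    5 * (C * C) + (2 * Yₘ * C + C * C)  ∎)
    where
    open ≡-Reasoning
    Yₘ = Y (suc m)
    C = c (suc m)
    W = w (suc m)
    square : ∀ Y C → Y * Y + 4 + (2 * Y * C + C * C) ≡ (Y + C) * (Y + C) + 4
    square = solve-∀
    four : ∀ W → (2 * W) * (2 * W) + 4 ≡ 4 * (W * W + 1)
    four = solve-∀
    twice : ∀ C W → 4 * (C * C + C * W) ≡ 4 * (C * C) + 2 * C * (2 * W)
    twice = solve-∀
    regroup : ∀ C Y → 4 * (C * C) + 2 * C * (Y + C) ≡ 5 * (C * C) + (2 * Y * C + C * C)
    regroup = solve-∀

  Y≤3c : ∀ m → Y (suc m) ≤ 3 * c (suc m)
  Y≤3c m = +-cancelʳ-≤ (c (suc m)) _ _ (begin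
    Y (suc m) + c (suc m)   ≡⟨ Y+c m ⟩
    2 * w (suc m)           ≤⟨ *-monoʳ-≤ 2 (w≤2c (suc m)) ⟩
    2 * (2 * c (suc m))     ≡⟨ four (c (suc m)) ⟩
    3 * c (suc m) + c (suc m) ∎)
    where
    open ≤-Reasoning
    four : ∀ C → 2 * (2 * C) ≡ 3 * C + C
    four = solve-∀

-- (6) Closed forms.  Over ℤ, v, u and a are explicit polynomials in m, c m and
-- w m; this yields the exact identity  20 S + n² Y = 5 n² c + L  with an
-- error term L = O(m c) that has nonnegative coefficients.
module ClosedForms where

  open import Data.Nat as ℕ using (ℕ; zero; suc)
  open import Data.Integer using (ℤ; +_; _+_; _*_; _-_)
  open import Data.Integer.Properties using (pos-*; +-injective)
  open import Data.Integer.Tactic.RingSolver using (solve-∀)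
  open import Relation.Binary.PropositionalEquality using (_≡_; refl; sym; trans; cong; cong₂; module ≡-Reasoning)
  open ElenaForests using (c; w; v; u; a)
  open ElenaStatistics using (S)
  open Fibonacci using (Y; Y+c)

  vForm uForm aForm : ℤ → ℤ → ℤ → ℤ
  vForm M C W = C + W - + 1
  uForm M C W = (M - M * M) * C + (+ 2 * M * M + + 2 * M - + 4) * W
  aForm M C W = (+ 3 * M * M - + 7 * M - + 10) * C + (+ 7 * M - M * M - + 2) * W + + 10

  record ClosedForm (m : ℕ) : Set where
    field
      v-closed : + v m ≡ vForm (+ m) (+ c m) (+ w m)
      u-closed : + 10 * + u m ≡ uForm (+ m) (+ c m) (+ w m)
      a-closed : + 10 * + a m ≡ aForm (+ m) (+ c m) (+ w m)

  -- The recursion of  next  preserves the closed forms (pure ring identities;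
  -- the next values of c and w are W + C and W + C + W).
  v-step : ∀ M C W → (W + C) + vForm M C W + W ≡ vForm (+ 1 + M) (W + C) (W + C + W)
  v-step = identity
    where
    identity : ∀ M C W → (W + C) + (C + W - + 1) + W ≡ (W + C) + (W + C + W) - + 1
    identity = solve-∀

  a-step : ∀ M C W → uForm M C W + + 10 * (M * C) + aForm M C W ≡ aForm (+ 1 + M) (W + C) (W + C + W)
  a-step = identity
    where
    identity : ∀ M C W →
      ((M - M * M) * C + (+ 2 * M * M + + 2 * M - + 4) * W) + + 10 * (M * C)
        + ((+ 3 * M * M - + 7 * M - + 10) * C + (+ 7 * M - M * M - + 2) * W + + 10)
      ≡ (+ 3 * (+ 1 + M) * (+ 1 + M) - + 7 * (+ 1 + M) - + 10) * (W + C)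
        + (+ 7 * (+ 1 + M) - (+ 1 + M) * (+ 1 + M) - + 2) * (W + C + W) + + 10
    identity = solve-∀

  u-step : ∀ M C W → aForm (+ 1 + M) (W + C) (W + C + W) + uForm M C W + + 10 * vForm M C W
                     ≡ uForm (+ 1 + M) (W + C) (W + C + W)
  u-step = identity
    where
    identity : ∀ M C W →
      ((+ 3 * (+ 1 + M) * (+ 1 + M) - + 7 * (+ 1 + M) - + 10) * (W + C)
        + (+ 7 * (+ 1 + M) - (+ 1 + M) * (+ 1 + M) - + 2) * (W + C + W) + + 10)
      + ((M - M * M) * C + (+ 2 * M * M + + 2 * M - + 4) * W) + + 10 * (C + W - + 1)
      ≡ ((+ 1 + M) - (+ 1 + M) * (+ 1 + M)) * (W + C)
        + (+ 2 * (+ 1 + M) * (+ 1 + M) + + 2 * (+ 1 + M) - + 4) * (W + C + W)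
    identity = solve-∀

  ten* : ∀ x y z → + 10 * (x + y + z) ≡ + 10 * x + + 10 * y + + 10 * z
  ten* = solve-∀

  closedForm : ∀ m → ClosedForm m
  closedForm zero = record { v-closed = refl ; u-closed = refl ; a-closed = refl }
  closedForm (suc m) = record { v-closed = v′ ; u-closed = u′ ; a-closed = a′ }
    where
    open ClosedForm (closedForm m)
    M = + m
    C = + c m
    W = + w m
    a′ : + 10 * + a (suc m) ≡ aForm (+ suc m) (+ c (suc m)) (+ w (suc m))
    a′ = begin
      + 10 * (+ u m + + (m ℕ.* c m) + + a m)   ≡⟨ cong (λ t → + 10 * (+ u m + t + + a m)) (pos-* m (c m)) ⟩
      + 10 * (+ u m + M * C + + a m)           ≡⟨ ten* (+ u m) (M * C) (+ a m) ⟩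
      + 10 * + u m + + 10 * (M * C) + + 10 * + a m ≡⟨ cong₂ (λ x y → x + + 10 * (M * C) + y) u-closed a-closed ⟩
      uForm M C W + + 10 * (M * C) + aForm M C W ≡⟨ a-step M C W ⟩
      aForm (+ 1 + M) (W + C) (W + C + W)      ∎
      where open ≡-Reasoning
    u′ : + 10 * + u (suc m) ≡ uForm (+ suc m) (+ c (suc m)) (+ w (suc m))
    u′ = begin
      + 10 * (+ a (suc m) + + u m + + v m)     ≡⟨ ten* (+ a (suc m)) (+ u m) (+ v m) ⟩
      + 10 * + a (suc m) + + 10 * + u m + + 10 * + v m
        ≡⟨ cong₂ _+_ (cong₂ _+_ a′ u-closed) (cong (+ 10 *_) v-closed) ⟩
      aForm (+ 1 + M) (W + C) (W + C + W) + uForm M C W + + 10 * vForm M C W ≡⟨ u-step M C W ⟩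
      uForm (+ 1 + M) (W + C) (W + C + W)      ∎
      where open ≡-Reasoning
    v′ : + v (suc m) ≡ vForm (+ suc m) (+ c (suc m)) (+ w (suc m))
    v′ = trans (cong (λ t → (W + C) + t + W) v-closed) (v-step M C W)

  -- The error term, for forests with m = m′ + 1 nodes (Elenas with
  -- n = m′ + 2 nodes).
  L : ℕ → ℕ
  L m′ = (23 ℕ.* m′ ℕ.+ 16) ℕ.* c (suc m′) ℕ.+ (9 ℕ.* m′ ℕ.+ 8) ℕ.* Y (suc m′) ℕ.+ 20

  -- 20 S = 20 c + 40 m c + 2 (10 a); eliminating a by its closed form and
  -- w by  2 w = Y + c  gives the identity.
  keyIdentity : ∀ m′ → let n = 2 ℕ.+ m′ in
    20 ℕ.* S (suc m′) ℕ.+ n ℕ.* n ℕ.* Y (suc m′) ≡ 5 ℕ.* (n ℕ.* n ℕ.* c (suc m′)) ℕ.+ L m′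
  keyIdentity m′ = +-injective (begin
    + (20 ℕ.* (C ℕ.+ 2 ℕ.* m ℕ.* C ℕ.+ A) ℕ.+ n ℕ.* n ℕ.* Yₘ)
      ≡⟨ cong₂ _+_ lhsCast (castProd₃ n n Yₘ) ⟩
    + 20 * (+ C + + 2 * + m * + C + + A) + + n * + n * + Yₘ
      ≡⟨ isolate-a M′ (+ C) (+ A) (+ Yₘ) ⟩
    + 2 * (+ 10 * + A) + (+ 20 * + C + + 40 * + m * + C + + n * + n * + Yₘ)
      ≡⟨ cong (λ t → + 2 * t + (+ 20 * + C + + 40 * + m * + C + + n * + n * + Yₘ)) (ClosedForm.a-closed (closedForm m)) ⟩
    + 2 * aForm (+ m) (+ C) (+ W) + (+ 20 * + C + + 40 * + m * + C + + n * + n * + Yₘ)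
      ≡⟨ isolate-2w M′ (+ C) (+ W) (+ Yₘ) ⟩
    (+ 7 * + m - + m * + m - + 2) * (+ 2 * + W) + κ M′ (+ C) (+ Yₘ)
      ≡⟨ cong (λ t → (+ 7 * + m - + m * + m - + 2) * t + κ M′ (+ C) (+ Yₘ)) twoW ⟩
    (+ 7 * + m - + m * + m - + 2) * (+ Yₘ + + C) + κ M′ (+ C) (+ Yₘ)
      ≡⟨ collect M′ (+ C) (+ Yₘ) ⟩
    + 5 * (+ n * + n * + C) + ((+ 23 * M′ + + 16) * + C + (+ 9 * M′ + + 8) * + Yₘ + + 20)
      ≡⟨ sym (cong₂ _+_ (trans (pos-* 5 (n ℕ.* n ℕ.* C)) (cong (+ 5 *_) (castProd₃ n n C))) LCast) ⟩
    + (5 ℕ.* (n ℕ.* n ℕ.* C) ℕ.+ L m′) ∎)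
    where
    open ≡-Reasoning
    m = suc m′
    n = suc m
    C = c m
    W = w m
    A = a m
    Yₘ = Y m
    M′ = + m′
    castProd₃ : ∀ x y z → + (x ℕ.* y ℕ.* z) ≡ + x * + y * + z
    castProd₃ x y z = trans (pos-* (x ℕ.* y) z) (cong (_* + z) (pos-* x y))
    castLinear : ∀ p q x → + ((p ℕ.* m′ ℕ.+ q) ℕ.* x) ≡ (+ p * M′ + + q) * + x
    castLinear p q x = trans (pos-* (p ℕ.* m′ ℕ.+ q) x) (cong (λ t → (t + + q) * + x) (pos-* p m′))
    lhsCast : + (20 ℕ.* (C ℕ.+ 2 ℕ.* m ℕ.* C ℕ.+ A)) ≡ + 20 * (+ C + + 2 * + m * + C + + A)
    lhsCast = trans (pos-* 20 (C ℕ.+ 2 ℕ.* m ℕ.* C ℕ.+ A)) (cong (λ t → + 20 * (+ C + t + + A)) (castProd₃ 2 m C))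
    LCast : + L m′ ≡ (+ 23 * M′ + + 16) * + C + (+ 9 * M′ + + 8) * + Yₘ + + 20
    LCast = cong₂ (λ x y → x + y + + 20) (castLinear 23 16 C) (castLinear 9 8 Yₘ)
    twoW : + 2 * + W ≡ + Yₘ + + C
    twoW = trans (sym (pos-* 2 W)) (cong +_ (sym (Y+c m′)))
    -- the part of 20 S + n² Y that does not involve w
    κ : ℤ → ℤ → ℤ → ℤ
    κ M′ C Y = (+ 2 * (+ 3 * (+ 1 + M′) * (+ 1 + M′) - + 7 * (+ 1 + M′) - + 10) + + 20 + + 40 * (+ 1 + M′)) * C
               + + 20 + (+ 2 + M′) * (+ 2 + M′) * Y
    isolate-a : ∀ M′ C A Y →
      + 20 * (C + + 2 * (+ 1 + M′) * C + A) + (+ 2 + M′) * (+ 2 + M′) * Y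
      ≡ + 2 * (+ 10 * A) + (+ 20 * C + + 40 * (+ 1 + M′) * C + (+ 2 + M′) * (+ 2 + M′) * Y)
    isolate-a = solve-∀
    isolate-2w : ∀ M′ C W Y →
      + 2 * ((+ 3 * (+ 1 + M′) * (+ 1 + M′) - + 7 * (+ 1 + M′) - + 10) * C
             + (+ 7 * (+ 1 + M′) - (+ 1 + M′) * (+ 1 + M′) - + 2) * W + + 10)
        + (+ 20 * C + + 40 * (+ 1 + M′) * C + (+ 2 + M′) * (+ 2 + M′) * Y)
      ≡ (+ 7 * (+ 1 + M′) - (+ 1 + M′) * (+ 1 + M′) - + 2) * (+ 2 * W)
        + ((+ 2 * (+ 3 * (+ 1 + M′) * (+ 1 + M′) - + 7 * (+ 1 + M′) - + 10) + + 20 + + 40 * (+ 1 + M′)) * C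
           + + 20 + (+ 2 + M′) * (+ 2 + M′) * Y)
    isolate-2w = solve-∀
    collect : ∀ M′ C Y →
      (+ 7 * (+ 1 + M′) - (+ 1 + M′) * (+ 1 + M′) - + 2) * (Y + C)
        + ((+ 2 * (+ 3 * (+ 1 + M′) * (+ 1 + M′) - + 7 * (+ 1 + M′) - + 10) + + 20 + + 40 * (+ 1 + M′)) * C
           + + 20 + (+ 2 + M′) * (+ 2 + M′) * Y)
      ≡ + 5 * ((+ 2 + M′) * (+ 2 + M′) * C) + ((+ 23 * M′ + + 16) * C + (+ 9 * M′ + + 8) * Y + + 20)
    collect = solve-∀

-- (7) The two estimates.  With n = m′ + 2 Elena nodes, C = c (m′+1) and
-- K = n² C, the identity of (6) reduces both bounds of the theorem to a
-- comparison of x C with B Y, where x/B is a rational approximation of √5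
-- from below (lower bound) or from above (upper bound).
module Estimates where

  open import Data.Nat using (ℕ; zero; suc; _+_; _*_; _∸_; _≤_; _<_; z≤n; s≤s; >-nonZero)
  open import Data.Nat.Properties
    using (_<?_; ≮⇒≥; <⇒≱; <⇒≤; ≤-trans; <-≤-trans; n≤1+n; m≤m+n; m<m+n; m≤n*m; m≤m*n; m+[n∸m]≡n;
           +-mono-≤; +-monoˡ-≤; +-monoʳ-≤; +-monoʳ-<; *-mono-≤; *-mono-<; *-monoˡ-≤; *-monoʳ-≤; *-monoˡ-<; *-monoʳ-<;
           +-cancelˡ-≤; +-cancelʳ-≤; +-cancelʳ-<; *-cancelʳ-≤; *-cancelˡ-<; module ≤-Reasoning)
  open import Data.Nat.Tactic.RingSolver using (solve-∀)
  open import Data.Product using (Σ; _×_; _,_)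
  open import Relation.Nullary using (yes; no; contradiction)
  open import Relation.Binary.PropositionalEquality using (_≡_; sym; cong; module ≡-Reasoning)
  open ElenaForests using (c)
  open ElenaStatistics using (S)
  open Fibonacci using (Y; Y²+4≡5c²; Y≤3c; c-pos; m≤c)
  open ClosedForms using (L; keyIdentity)

  sq-cancel-< : ∀ p q → p * p < q * q → p < q
  sq-cancel-< p q p²<q² with p <? q
  ... | yes p<q = p<q
  ... | no p≮q = contradiction (*-mono-≤ (≮⇒≥ p≮q) (≮⇒≥ p≮q)) (<⇒≱ p²<q²)

  below-√5 : ∀ B C x Y → 1 ≤ C → 5 * (B * B) < x * x → Y * Y + 4 ≡ 5 * (C * C) → B * Y < x * C
  below-√5 B C@(suc _) x Y _ 5B²<x² Y²+4 = sq-cancel-< (B * Y) (x * C) (begin-strict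
    (B * Y) * (B * Y)              ≤⟨ m≤m+n _ (4 * (B * B)) ⟩
    (B * Y) * (B * Y) + 4 * (B * B) ≡⟨ factor B Y ⟩
    (B * B) * (Y * Y + 4)          ≡⟨ cong ((B * B) *_) Y²+4 ⟩
    (B * B) * (5 * (C * C))        ≡⟨ commute B C ⟩
    (5 * (B * B)) * (C * C)        <⟨ *-monoˡ-< (C * C) 5B²<x² ⟩
    (x * x) * (C * C)              ≡⟨ swap x C ⟩
    (x * C) * (x * C)              ∎)
    where
    open ≤-Reasoning
    factor : ∀ B Y → (B * Y) * (B * Y) + 4 * (B * B) ≡ (B * B) * (Y * Y + 4)
    factor = solve-∀
    commute : ∀ B C → (B * B) * (5 * (C * C)) ≡ (5 * (B * B)) * (C * C)
    commute = solve-∀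
    swap : ∀ x C → (x * x) * (C * C) ≡ (x * C) * (x * C)
    swap = solve-∀

  -- If x/B < √5 and C is large compared with B, then x C < B Y by a margin
  -- D with  C ≤ 12 B D:  the identity  (BY)² - (xC)² ≥ C² - 4B²  bounds
  -- D (BY + xC) from below, and BY + xC ≤ 6 B C.
  above-√5 : ∀ B C x Y → x * x < 5 * (B * B) → Y * Y + 4 ≡ 5 * (C * C) → Y ≤ 3 * C → 8 * (B * B) ≤ C →
             Σ ℕ λ D → (x * C + D ≡ B * Y) × (C ≤ 12 * B * D)
  above-√5 B C x Y x²<5B² Y²+4 Y≤3C 8B²≤C = D , xC+D≡BY , C≤12BD
    where
    open ≤-Reasoning
    B>0 : 0 < B
    B>0 = positive B x²<5B²
      where
      positive : ∀ B → x * x < 5 * (B * B) → 0 < B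
      positive (suc _) _ = s≤s z≤n
      positive zero ()
    C>0 : 0 < C
    C>0 = ≤-trans (*-mono-≤ B>0 B>0) (≤-trans (m≤n*m (B * B) 8) 8B²≤C)
    x<3B : x < 3 * B
    x<3B = sq-cancel-< x (3 * B) (begin-strict
      x * x         <⟨ x²<5B² ⟩
      5 * (B * B)   ≤⟨ *-monoˡ-≤ (B * B) (m≤m+n 5 4) ⟩
      9 * (B * B)   ≡⟨ nine B ⟩
      3 * B * (3 * B) ∎)
      where
      nine : ∀ B → 9 * (B * B) ≡ 3 * B * (3 * B)
      nine = solve-∀
    squares : (x * C) * (x * C) + C * C ≤ (B * Y) * (B * Y) + 4 * (B * B)
    squares = begin
      (x * C) * (x * C) + C * C      ≡⟨ factorC x C ⟩
      suc (x * x) * (C * C)          ≤⟨ *-monoˡ-≤ (C * C) x²<5B² ⟩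
      (5 * (B * B)) * (C * C)        ≡⟨ commute B C ⟩
      (B * B) * (5 * (C * C))        ≡⟨ cong ((B * B) *_) (sym Y²+4) ⟩
      (B * B) * (Y * Y + 4)          ≡⟨ factorB B Y ⟩
      (B * Y) * (B * Y) + 4 * (B * B) ∎
      where
      factorC : ∀ x C → (x * C) * (x * C) + C * C ≡ suc (x * x) * (C * C)
      factorC = solve-∀
      commute : ∀ B C → (5 * (B * B)) * (C * C) ≡ (B * B) * (5 * (C * C))
      commute = solve-∀
      factorB : ∀ B Y → (B * B) * (Y * Y + 4) ≡ (B * Y) * (B * Y) + 4 * (B * B)
      factorB = solve-∀
    8B²≤C² : 8 * (B * B) ≤ C * C
    8B²≤C² = ≤-trans 8B²≤C (m≤m*n C C {{>-nonZero C>0}})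
    4B²<C² : 4 * (B * B) < C * C
    4B²<C² = <-≤-trans (*-monoˡ-< (B * B) {{>-nonZero (*-mono-< B>0 B>0)}} {4} {8} (m<m+n 4 (s≤s z≤n))) 8B²≤C²
    xC<BY : x * C < B * Y
    xC<BY = sq-cancel-< (x * C) (B * Y) (+-cancelʳ-< (4 * (B * B)) _ _ (begin-strict
      (x * C) * (x * C) + 4 * (B * B) <⟨ +-monoʳ-< ((x * C) * (x * C)) 4B²<C² ⟩
      (x * C) * (x * C) + C * C       ≤⟨ squares ⟩
      (B * Y) * (B * Y) + 4 * (B * B) ∎))
    D = B * Y ∸ x * C
    xC+D≡BY : x * C + D ≡ B * Y
    xC+D≡BY = m+[n∸m]≡n (<⇒≤ xC<BY)
    BY+xC≤6BC : B * Y + x * C ≤ 6 * B * C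
    BY+xC≤6BC = begin
      B * Y + x * C             ≤⟨ +-mono-≤ (*-monoʳ-≤ B Y≤3C) (*-monoˡ-≤ C (<⇒≤ x<3B)) ⟩
      B * (3 * C) + 3 * B * C   ≡⟨ six B C ⟩
      6 * B * C                 ∎
      where
      six : ∀ B C → B * (3 * C) + 3 * B * C ≡ 6 * B * C
      six = solve-∀
    C²≤ : C * C ≤ 6 * B * C * D + 4 * (B * B)
    C²≤ = +-cancelˡ-≤ ((x * C) * (x * C)) _ _ (begin
      (x * C) * (x * C) + C * C               ≤⟨ squares ⟩
      (B * Y) * (B * Y) + 4 * (B * B)         ≡⟨ cong (λ t → t * t + 4 * (B * B)) (sym xC+D≡BY) ⟩
      (x * C + D) * (x * C + D) + 4 * (B * B) ≡⟨ expand (x * C) D (4 * (B * B)) ⟩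
      (x * C) * (x * C) + (D * ((x * C + D) + x * C) + 4 * (B * B))
        ≡⟨ cong (λ t → (x * C) * (x * C) + (D * (t + x * C) + 4 * (B * B))) xC+D≡BY ⟩
      (x * C) * (x * C) + (D * (B * Y + x * C) + 4 * (B * B))
        ≤⟨ +-monoʳ-≤ ((x * C) * (x * C)) (+-monoˡ-≤ (4 * (B * B)) (*-monoʳ-≤ D BY+xC≤6BC)) ⟩
      (x * C) * (x * C) + (D * (6 * B * C) + 4 * (B * B))
        ≡⟨ cong (λ t → (x * C) * (x * C) + (t + 4 * (B * B))) (reorder D B C) ⟩
      (x * C) * (x * C) + (6 * B * C * D + 4 * (B * B)) ∎)
      where
      expand : ∀ p d k → (p + d) * (p + d) + k ≡ p * p + (d * ((p + d) + p) + k)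
      expand = solve-∀
      reorder : ∀ D B C → D * (6 * B * C) ≡ 6 * B * C * D
      reorder = solve-∀
    C≤12BD : C ≤ 12 * B * D
    C≤12BD = *-cancelʳ-≤ C (12 * B * D) C {{>-nonZero C>0}} (+-cancelʳ-≤ (C * C) _ _ (begin
      C * C + C * C                       ≡⟨ double (C * C) ⟩
      2 * (C * C)                         ≤⟨ *-monoʳ-≤ 2 C²≤ ⟩
      2 * (6 * B * C * D + 4 * (B * B))   ≡⟨ distribute B C D ⟩
      12 * B * D * C + 8 * (B * B)        ≤⟨ +-monoʳ-≤ (12 * B * D * C) 8B²≤C² ⟩
      12 * B * D * C + C * C              ∎))
      where
      double : ∀ x → x + x ≡ 2 * x
      double = solve-∀
      distribute : ∀ B C D → 2 * (6 * B * C * D + 4 * (B * B)) ≡ 12 * B * D * C + 8 * (B * B)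
      distribute = solve-∀

  L≤ : ∀ m′ → L m′ ≤ (50 * m′ + 60) * c (suc m′)
  L≤ m′ = begin
    (23 * m′ + 16) * C + (9 * m′ + 8) * Y (suc m′) + 20
      ≤⟨ +-mono-≤ (+-monoʳ-≤ ((23 * m′ + 16) * C) (*-monoʳ-≤ (9 * m′ + 8) (Y≤3c m′))) (*-monoʳ-≤ 20 (c-pos (suc m′))) ⟩
    (23 * m′ + 16) * C + (9 * m′ + 8) * (3 * C) + 20 * C
      ≡⟨ collect m′ C ⟩
    (50 * m′ + 60) * C ∎
    where
    open ≤-Reasoning
    C = c (suc m′)
    collect : ∀ m C → (23 * m + 16) * C + (9 * m + 8) * (3 * C) + 20 * C ≡ (50 * m + 60) * C
    collect = solve-∀

  smallError : ∀ B m′ → 600 * (B * B) ≤ m′ → 12 * (B * B) * (50 * m′ + 60) < (2 + m′) * (2 + m′)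
  smallError B m′ big = begin-strict
    12 * (B * B) * (50 * m′ + 60)                    ≡⟨ split (B * B) m′ ⟩
    600 * (B * B) * m′ + (600 * (B * B) + 120 * (B * B))
      ≤⟨ +-mono-≤ (*-monoˡ-≤ m′ big) (+-mono-≤ big (≤-trans (*-monoˡ-≤ (B * B) (m≤m+n 120 480)) big)) ⟩
    m′ * m′ + (m′ + m′)                              <⟨ m<m+n (m′ * m′ + (m′ + m′)) {4 + 2 * m′} (s≤s z≤n) ⟩
    m′ * m′ + (m′ + m′) + (4 + 2 * m′)               ≡⟨ square m′ ⟩
    (2 + m′) * (2 + m′)                              ∎
    where
    open ≤-Reasoning
    split : ∀ K m → 12 * K * (50 * m + 60) ≡ 600 * K * m + (600 * K + 120 * K)
    split = solve-∀
    square : ∀ m → m * m + (m + m) + (4 + 2 * m) ≡ (2 + m) * (2 + m)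
    square = solve-∀

  keyIdentity×B : ∀ m′ B → let n = 2 + m′ in
    20 * S (suc m′) * B + n * n * (B * Y (suc m′)) ≡ 5 * B * (n * n * c (suc m′)) + B * L m′
  keyIdentity×B m′ B = begin
    20 * S m * B + n * n * (B * Y m)          ≡⟨ pull B (S m) (n * n) (Y m) ⟩
    B * (20 * S m + n * n * Y m)              ≡⟨ cong (B *_) (keyIdentity m′) ⟩
    B * (5 * (n * n * c m) + L m′)            ≡⟨ push B (n * n * c m) (L m′) ⟩
    5 * B * (n * n * c m) + B * L m′          ∎
    where
    open ≡-Reasoning
    m = suc m′
    n = 2 + m′
    pull : ∀ B S N Y → 20 * S * B + N * (B * Y) ≡ B * (20 * S + N * Y)
    pull = solve-∀
    push : ∀ B K L → B * (5 * K + L) ≡ 5 * B * K + B * L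
    push = solve-∀

  lowerBound : ∀ m′ B x → 5 * (B * B) < x * x → let n = 2 + m′ ; K = n * n * c (suc m′) in
    5 * B * K < 20 * S (suc m′) * B + x * K
  lowerBound m′ B x 5B²<x² = begin-strict
    5 * B * K                         ≤⟨ m≤m+n (5 * B * K) (B * L m′) ⟩
    5 * B * K + B * L m′              ≡⟨ sym (keyIdentity×B m′ B) ⟩
    20 * S m * B + n * n * (B * Y m)  <⟨ +-monoʳ-< (20 * S m * B) (*-monoʳ-< (n * n) BY<xC) ⟩
    20 * S m * B + n * n * (x * C)    ≡⟨ cong (20 * S m * B +_) (reorder (n * n) x C) ⟩
    20 * S m * B + x * K              ∎
    where
    open ≤-Reasoning
    m = suc m′
    n = 2 + m′
    C = c m
    K = n * n * C
    BY<xC : B * Y m < x * C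
    BY<xC = below-√5 B C x (Y m) (c-pos m) 5B²<x² (Y²+4≡5c² m′)
    reorder : ∀ N x C → N * (x * C) ≡ x * (N * C)
    reorder = solve-∀

  upperBound : ∀ m′ B x → x * x < 5 * (B * B) → 600 * (B * B) ≤ m′ →
    let n = 2 + m′ ; K = n * n * c (suc m′) in 20 * S (suc m′) * B + x * K < 5 * B * K
  upperBound m′ B x x²<5B² big = conclude (above-√5 B C x (Y m) x²<5B² (Y²+4≡5c² m′) (Y≤3c m′) 8B²≤C)
    where
    open ≤-Reasoning
    m = suc m′
    n = 2 + m′
    C = c m
    K = n * n * C
    8B²≤C : 8 * (B * B) ≤ C
    8B²≤C = ≤-trans (*-monoˡ-≤ (B * B) (m≤m+n 8 592)) (≤-trans big (≤-trans (n≤1+n m′) (m≤c m)))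
    regroup : ∀ T x N C D → T + x * (N * C) + N * D ≡ T + N * (x * C + D)
    regroup = solve-∀
    conclude : Σ ℕ (λ D → (x * C + D ≡ B * Y m) × (C ≤ 12 * B * D)) → 20 * S m * B + x * K < 5 * B * K
    conclude (D , xC+D≡BY , C≤12BD) = +-cancelʳ-< (B * L m′) _ _ (begin-strict
      20 * S m * B + x * K + B * L m′       <⟨ +-monoʳ-< (20 * S m * B + x * K) BL<n²D ⟩
      20 * S m * B + x * K + n * n * D      ≡⟨ regroup (20 * S m * B) x (n * n) C D ⟩
      20 * S m * B + n * n * (x * C + D)    ≡⟨ cong (λ t → 20 * S m * B + n * n * t) xC+D≡BY ⟩
      20 * S m * B + n * n * (B * Y m)      ≡⟨ keyIdentity×B m′ B ⟩
      5 * B * K + B * L m′                  ∎)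
      where
      BL<n²D : B * L m′ < n * n * D
      BL<n²D = *-cancelˡ-< (12 * B) _ _ (begin-strict
        12 * B * (B * L m′)                ≡⟨ reassoc₁ B (L m′) ⟩
        12 * B * B * L m′                  ≤⟨ *-monoʳ-≤ (12 * B * B) (L≤ m′) ⟩
        12 * B * B * ((50 * m′ + 60) * C)  ≡⟨ reassoc₂ B m′ C ⟩
        12 * (B * B) * (50 * m′ + 60) * C  <⟨ *-monoˡ-< C {{>-nonZero (c-pos m)}} (smallError B m′ big) ⟩
        n * n * C                          ≤⟨ *-monoʳ-≤ (n * n) C≤12BD ⟩
        n * n * (12 * B * D)               ≡⟨ swap (n * n) B D ⟩
        12 * B * (n * n * D)               ∎)
        where
        reassoc₁ : ∀ B L → 12 * B * (B * L) ≡ 12 * B * B * L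
        reassoc₁ = solve-∀
        reassoc₂ : ∀ B m C → 12 * B * B * ((50 * m + 60) * C) ≡ 12 * (B * B) * (50 * m + 60) * C
        reassoc₂ = solve-∀
        swap : ∀ N B D → N * (12 * B * D) ≡ 12 * B * (N * D)
        swap = solve-∀

-- (8) Translating to integers.  For a rational q = a / B (B = den q) put
-- X = 5B - 20a.  Then q lies below (5 - √5)/20 iff X > 0 and X² > 5B², and
-- above it iff X < 0 or X² < 5B²; and q · n < S / d iff  a n d < S B.
module RationalCuts where

  open import Data.Nat as ℕ using (ℕ; suc; s≤s; z≤n)
  import Data.Nat.Properties as ℕP
  open import Data.Integer as ℤ using (ℤ; +_; -[1+_]; _+_; _*_; _-_; -_; _<_; +<+)
  import Data.Integer.Properties as ℤP
  open import Data.Integer.Properties using (pos-*)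
  open import Data.Integer.Tactic.RingSolver using (solve-∀)
  open import Data.Rational as ℚ using (ℚ; mkℚ; toℚᵘ)
  open import Data.Rational.Properties using (toℚᵘ-homo-*; toℚᵘ-homo-+; toℚᵘ-homo‿-; toℚᵘ-fromℚᵘ; toℚᵘ-mono-<; toℚᵘ-cancel-<)
  open import Data.Rational.Unnormalised as ℚᵘ using (mkℚᵘ; _≃_; *≡*; *<*)
  open import Data.Rational.Unnormalised.Properties using (≃-trans; ≃-sym; ≃-refl; +-cong; -‿cong; *-cong; <-respˡ-≃; <-respʳ-≃; drop-*<*)
  open import Data.Product using (Σ; _×_; _,_; proj₁; proj₂)
  open import Data.Sum using (_⊎_; inj₁; inj₂)
  open import Relation.Binary.PropositionalEquality using (_≡_; refl; sym; trans; cong; subst; subst₂; module ≡-Reasoning)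

  num : ℚ → ℤ
  num = ℚ.numerator

  den : ℚ → ℕ
  den q = suc (ℚ.denominator-1 q)

  -- X = (5 - 20 q) · den q
  X : ℚ → ℤ
  X q = + 5 * + den q - + 20 * num q

  toℚᵘ-ℕ→ℚ : ∀ k → toℚᵘ (ℕ→ℚ k) ≃ mkℚᵘ (+ k) 0
  toℚᵘ-ℕ→ℚ k = toℚᵘ-fromℚᵘ (mkℚᵘ (+ k) 0)

  X-repr : ∀ q → toℚᵘ (ℕ→ℚ 5 ℚ.- ℕ→ℚ 20 ℚ.* q) ≃ mkℚᵘ (X q) (ℚ.denominator-1 q)
  X-repr q@(mkℚ a b _) =
    ≃-trans (toℚᵘ-homo-+ (ℕ→ℚ 5) (ℚ.- (ℕ→ℚ 20 ℚ.* q)))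
      (≃-trans (+-cong (toℚᵘ-ℕ→ℚ 5) (≃-trans (toℚᵘ-homo‿- (ℕ→ℚ 20 ℚ.* q))
                 (-‿cong (≃-trans (toℚᵘ-homo-* (ℕ→ℚ 20) q) (*-cong (toℚᵘ-ℕ→ℚ 20) (≃-refl {toℚᵘ q}))))))
        (*≡* (clear (1 ℕ.* suc b) (1 ℕ.* (1 ℕ.* suc b)) (ℕP.*-identityˡ (suc b))
                    (trans (ℕP.*-identityˡ _) (ℕP.*-identityˡ (suc b))))))
    where
    identity : ∀ (B a : ℤ) → (+ 5 * B + (- (+ 20 * a)) * + 1) * B ≡ (+ 5 * B - + 20 * a) * B
    identity = solve-∀
    clear : ∀ k k′ → k ≡ suc b → k′ ≡ suc b →
      (+ 5 * + k + (- (+ 20 * a)) * + 1) * + suc b ≡ X q * + k′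
    clear _ _ refl refl = identity (+ suc b) a

  X²-repr : ∀ q → toℚᵘ ((ℕ→ℚ 5 ℚ.- ℕ→ℚ 20 ℚ.* q) ℚ.* (ℕ→ℚ 5 ℚ.- ℕ→ℚ 20 ℚ.* q))
                  ≃ mkℚᵘ (X q) (ℚ.denominator-1 q) ℚᵘ.* mkℚᵘ (X q) (ℚ.denominator-1 q)
  X²-repr q = ≃-trans (toℚᵘ-homo-* r r) (*-cong (X-repr q) (X-repr q))
    where r = ℕ→ℚ 5 ℚ.- ℕ→ℚ 20 ℚ.* q

  five-den² : ∀ q → + 5 * + (den q ℕ.* den q) ≡ + 5 * (+ den q * + den q)
  five-den² q = cong (+ 5 *_) (pos-* (den q) (den q))

  below-c⇒ : ∀ q → below-c q → (+ 0 < X q) × (+ 5 * (+ den q * + den q) < X q * X q)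
  below-c⇒ q@(mkℚ a b _) (pos , sq) =
    subst (+ 0 <_) (ℤP.*-identityʳ (X q)) (drop-*<* (<-respʳ-≃ (X-repr q) (toℚᵘ-mono-< pos))) ,
    subst₂ _<_ (five-den² q) (ℤP.*-identityʳ _)
      (drop-*<* (<-respˡ-≃ (toℚᵘ-ℕ→ℚ 5) (<-respʳ-≃ (X²-repr q) (toℚᵘ-mono-< sq))))

  above-c⇒ : ∀ q → above-c q → (X q < + 0) ⊎ (X q * X q < + 5 * (+ den q * + den q))
  above-c⇒ q@(mkℚ a b _) (inj₁ neg) =
    inj₁ (subst (_< + 0) (ℤP.*-identityʳ (X q)) (drop-*<* (<-respˡ-≃ (X-repr q) (toℚᵘ-mono-< neg))))
  above-c⇒ q@(mkℚ a b _) (inj₂ sq) =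
    inj₂ (subst₂ _<_ (ℤP.*-identityʳ _) (five-den² q)
      (drop-*<* (<-respʳ-≃ (toℚᵘ-ℕ→ℚ 5) (<-respˡ-≃ (X²-repr q) (toℚᵘ-mono-< sq)))))

  20a+X : ∀ q → + 20 * num q + X q ≡ + (5 ℕ.* den q)
  20a+X q = trans (identity (num q) (+ den q)) (sym (pos-* 5 (den q)))
    where
    identity : ∀ a B → + 20 * a + (+ 5 * B - + 20 * a) ≡ + 5 * B
    identity = solve-∀

  squares-ℕ : ∀ x B → + x * + x ≡ + (x ℕ.* x) × + 5 * (+ B * + B) ≡ + (5 ℕ.* (B ℕ.* B))
  squares-ℕ x B = sym (pos-* x x) , trans (cong (+ 5 *_) (sym (pos-* B B))) (sym (pos-* 5 (B ℕ.* B)))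

  below-c⇒ℕ : ∀ q → below-c q → Σ ℕ λ x →
    (5 ℕ.* (den q ℕ.* den q) ℕ.< x ℕ.* x) × (+ 20 * num q + + x ≡ + (5 ℕ.* den q))
  below-c⇒ℕ q h with X q | 20a+X q | below-c⇒ q h
  ... | + x | 20a+x | _ , sq = x , ℤP.drop‿+<+ (subst₂ _<_ five-B² x² sq) , 20a+x
    where
    x² = proj₁ (squares-ℕ x (den q))
    five-B² = proj₂ (squares-ℕ x (den q))
  ... | -[1+ _ ] | _ | () , _

  above-c⇒ℕ : ∀ q → above-c q → Σ ℕ λ x → Σ ℕ λ e →
    (x ℕ.* x ℕ.< 5 ℕ.* (den q ℕ.* den q)) × (+ 20 * num q + + x ≡ + (5 ℕ.* den q ℕ.+ e))
  above-c⇒ℕ q h with X q | 20a+X q | above-c⇒ q h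
  ... | + x | _ | inj₁ (+<+ ())
  ... | + x | 20a+x | inj₂ sq = x , 0 , ℤP.drop‿+<+ (subst₂ _<_ x² five-B² sq) ,
                                trans 20a+x (cong +_ (sym (ℕP.+-identityʳ _)))
    where
    x² = proj₁ (squares-ℕ x (den q))
    five-B² = proj₂ (squares-ℕ x (den q))
  ... | -[1+ k ] | 20a+X≡5B | _ = 0 , suc k , s≤s z≤n , move (+ 20 * num q) -[1+ k ] (+ (5 ℕ.* den q)) 20a+X≡5B
    where
    move : ∀ A Y N → A + Y ≡ N → A + + 0 ≡ N - Y
    move A Y N refl = identity A Y
      where
      identity : ∀ A Y → A + + 0 ≡ A + Y - Y
      identity = solve-∀

  +-cancelʳ-< : ∀ i j k → i + k < j + k → i < j
  +-cancelʳ-< i j k lt = subst₂ _<_ (cancel i k) (cancel j k) (ℤP.+-monoˡ-< (- k) lt)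
    where
    cancel : ∀ i k → i + k + - k ≡ i
    cancel = solve-∀

  scale : ∀ a x p K → + 20 * a + + x ≡ + p → + 20 * (a * + K) + + (x ℕ.* K) ≡ + (p ℕ.* K)
  scale a x p K eq = begin
    + 20 * (a * + K) + + (x ℕ.* K)   ≡⟨ cong (λ t → + 20 * (a * + K) + t) (pos-* x K) ⟩
    + 20 * (a * + K) + + x * + K     ≡⟨ distribute a (+ x) (+ K) ⟩
    (+ 20 * a + + x) * + K           ≡⟨ cong (_* + K) eq ⟩
    + p * + K                        ≡⟨ sym (pos-* p K) ⟩
    + (p ℕ.* K)                      ∎
    where
    open ≡-Reasoning
    distribute : ∀ a x K → + 20 * (a * K) + x * K ≡ (+ 20 * a + x) * K
    distribute = solve-∀

  twenty-SB : ∀ S B → + (20 ℕ.* S ℕ.* B) ≡ + 20 * + (S ℕ.* B)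
  twenty-SB S B = trans (cong +_ (ℕP.*-assoc 20 S B)) (pos-* 20 (S ℕ.* B))

  lower-ℤ : ∀ a x B S K → + 20 * a + + x ≡ + (5 ℕ.* B) →
    5 ℕ.* B ℕ.* K ℕ.< 20 ℕ.* S ℕ.* B ℕ.+ x ℕ.* K → a * + K < + (S ℕ.* B)
  lower-ℤ a x B S K eq lt = ℤP.*-cancelˡ-<-nonNeg (+ 20) (+-cancelʳ-< _ _ (+ (x ℕ.* K)) (subst₂ _<_
    (sym (scale a x (5 ℕ.* B) K eq)) (cong (_+ + (x ℕ.* K)) (twenty-SB S B)) (+<+ lt)))

  upper-ℤ : ∀ a x e B S K → + 20 * a + + x ≡ + (5 ℕ.* B ℕ.+ e) →
    20 ℕ.* S ℕ.* B ℕ.+ x ℕ.* K ℕ.< 5 ℕ.* B ℕ.* K → + (S ℕ.* B) < a * + K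
  upper-ℤ a x e B S K eq lt = ℤP.*-cancelˡ-<-nonNeg (+ 20) (+-cancelʳ-< _ _ (+ (x ℕ.* K)) (subst₂ _<_
    (cong (_+ + (x ℕ.* K)) (twenty-SB S B)) (sym (scale a x (5 ℕ.* B ℕ.+ e) K eq))
    (+<+ (ℕP.<-≤-trans lt (ℕP.*-monoˡ-≤ K (ℕP.m≤m+n (5 ℕ.* B) e))))))

  product-repr : ∀ q n → toℚᵘ (q ℚ.* ℕ→ℚ n) ≃ mkℚᵘ (num q ℤ.* + n) (ℚ.denominator-1 q)
  product-repr q@(mkℚ a b _) n = ≃-trans (toℚᵘ-homo-* q (ℕ→ℚ n))
    (≃-trans (*-cong (≃-refl {toℚᵘ q}) (toℚᵘ-ℕ→ℚ n)) (*≡* (cong ((a * + n) *_) (cong (λ k → + suc k) (sym (ℕP.*-identityʳ b))))))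

  cross : ∀ a n d → a * + (n ℕ.* suc d) ≡ (a * + n) * + suc d
  cross a n d = trans (cong (a *_) (pos-* n (suc d))) (sym (ℤP.*-assoc a (+ n) (+ suc d)))

  *ℕ<fraction : ∀ q n S d → num q * + (n ℕ.* suc d) < + (S ℕ.* den q) → q ℚ.* ℕ→ℚ n ℚ.< (+ S) ℚ./ suc d
  *ℕ<fraction q n S d lt = toℚᵘ-cancel-< (<-respˡ-≃ (≃-sym (product-repr q n))
    (<-respʳ-≃ (≃-sym (toℚᵘ-fromℚᵘ (mkℚᵘ (+ S) d))) (*<* (subst₂ _<_ (cross (num q) n d) (pos-* S (den q)) lt))))

  fraction<*ℕ : ∀ q n S d → + (S ℕ.* den q) < num q * + (n ℕ.* suc d) → (+ S) ℚ./ suc d ℚ.< q ℚ.* ℕ→ℚ n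
  fraction<*ℕ q n S d lt = toℚᵘ-cancel-< (<-respʳ-≃ (≃-sym (product-repr q n))
    (<-respˡ-≃ (≃-sym (toℚᵘ-fromℚᵘ (mkℚᵘ (+ S) d))) (*<* (subst₂ _<_ (pos-* S (den q)) (cross (num q) n d) lt))))

-- (9) The mean number of ascendants of an Elena with n = m′ + 2 nodes lies
-- between l n and u n once m′ ≥ 600 den(u)².
module Bounds where

  open import Data.Nat as ℕ using (ℕ; suc; _+_; _*_; _≤_; _≥_; z≤n; s≤s)
  open import Data.Nat.Properties using (*-assoc; *-mono-≤)
  open import Data.Rational as ℚ using (ℚ; _<_)
  open import Data.Product using (Σ; _×_; _,_)
  open import Relation.Binary.PropositionalEquality using (_≡_; refl; sym; trans; cong; subst)
  open ElenaForests using (c)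
  open ElenaStatistics using (S; expectedAvgAsc-formula)
  open Fibonacci using (c-pos)
  open Estimates using (lowerBound; upperBound)
  open RationalCuts

  denominator : ∀ m′ → Σ ℕ λ d → (2 + m′) * c (suc m′) ≡ suc d
  denominator m′ = positive (*-mono-≤ {1} {2 + m′} (s≤s z≤n) (c-pos (suc m′)))
    where
    positive : ∀ {k} → 1 ≤ k → Σ ℕ λ d → k ≡ suc d
    positive {suc d} _ = d , refl

  reassociate : ∀ n C d → n * C ≡ suc d → n * suc d ≡ n * n * C
  reassociate n C d nC≡d+1 = trans (cong (n *_) (sym nC≡d+1)) (sym (*-assoc n n C))

  lowerBoundℚ : ∀ l → below-c l → ∀ m′ → l ℚ.* ℕ→ℚ (2 + m′) < expectedAvgAsc (2 + m′)
  lowerBoundℚ l below m′ with denominator m′ | below-c⇒ℕ l below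
  ... | d , nC≡d+1 | x , 5B²<x² , 20a+x≡5B =
    subst (l ℚ.* ℕ→ℚ n <_) (sym (expectedAvgAsc-formula (suc m′) d nC≡d+1))
      (*ℕ<fraction l n (S (suc m′)) d (lower-ℤ (num l) x (den l) (S (suc m′)) (n * suc d) 20a+x≡5B
        (subst (λ K → 5 * den l * K ℕ.< 20 * S (suc m′) * den l + x * K)
               (sym (reassociate n (c (suc m′)) d nC≡d+1)) (lowerBound m′ (den l) x 5B²<x²))))
    where
    n = 2 + m′

  upperBoundℚ : ∀ u → above-c u → ∀ m′ → 600 * (den u * den u) ≤ m′ → expectedAvgAsc (2 + m′) < u ℚ.* ℕ→ℚ (2 + m′)
  upperBoundℚ u above m′ large with denominator m′ | above-c⇒ℕ u above
  ... | d , nC≡d+1 | x , e , x²<5B² , 20a+x≡5B+e =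
    subst (_< u ℚ.* ℕ→ℚ n) (sym (expectedAvgAsc-formula (suc m′) d nC≡d+1))
      (fraction<*ℕ u n (S (suc m′)) d (upper-ℤ (num u) x e (den u) (S (suc m′)) (n * suc d) 20a+x≡5B+e
        (subst (λ K → 20 * S (suc m′) * den u + x * K ℕ.< 5 * den u * K)
               (sym (reassociate n (c (suc m′)) d nC≡d+1)) (upperBound m′ (den u) x x²<5B² large))))
    where
    n = 2 + m′

  threshold : ℚ → ℕ
  threshold u = 2 + 600 * (den u * den u)

  meanBounds : ∀ l u → below-c l → above-c u → ∀ n → n ≥ threshold u →
               (l ℚ.* ℕ→ℚ n < expectedAvgAsc n) × (expectedAvgAsc n < u ℚ.* ℕ→ℚ n)
  meanBounds l u below above (suc (suc m′)) (s≤s (s≤s large)) =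
    lowerBoundℚ l below m′ , upperBoundℚ u above m′ large

open import Data.Nat using (ℕ; _≥_)
open import Data.Rational using (ℚ; _*_; _<_)
open import Data.Product using (_×_; ∃; _,_)
open import Relation.Binary.PropositionalEquality using (_≡_)
open DescendantsAndAscendants using (expectedAvgDesc≡expectedAvgAsc)
open Bounds using (threshold; meanBounds)

mainTheorem7 :
    ((l u : ℚ) → below-c l → above-c u →
      ∃ λ N → (n : ℕ) → n ≥ N →
        (l * ℕ→ℚ n < expectedAvgAsc n) × (expectedAvgAsc n < u * ℕ→ℚ n))
    × ((n : ℕ) → expectedAvgDesc n ≡ expectedAvgAsc n)
mainTheorem7 =
  (λ l u below above → threshold u , meanBounds l u below above) ,
  expectedAvgDesc≡expectedAvgAsc
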